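{- Let $\sigma$ be an $n$-cycle of $\{1,\dots,n\}$ with $|\sigma(i)-i|\ge 2$ for all $1\le i\le n$. Then the number of $C$-pairs of $\sigma$ is at least the number of $UR$-indices of $\sigma$.
   Context: An ordered pair $(i,j)$ is a $C$-pair of $\sigma$ if $i<j<\sigma(i)<\sigma(j)$ or $i>j>\sigma(i)>\sigma(j)$. An index $i$ is a $UR$-index of $\sigma$ if $\sigma^{ -1}(i)<i$ and $\sigma(i)<i$. -}

module Defs where

open import Data.Nat using (ℕ; zero; suc; _<_; _≤_; _∸_)
import Data.Nat as ℕ
open import Data.Fin using (Fin; toℕ)
open import Data.Fin.Permutation using (Permutation′; _⟨$⟩ʳ_; _⟨$⟩ˡ_)
open import Data.List using (List; length; filter; cartesianProduct; allFin)
open import Data.Product using (_×_; _,_; ∃; proj₁; proj₂)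
open import Data.Sum using (_⊎_)
open import Relation.Binary.PropositionalEquality using (_≡_)
open import Relation.Nullary using (Dec)
open import Relation.Nullary.Decidable using (_×-dec_; _⊎-dec_)

-- Elements of {1,…,n} are represented by Fin n (i ↦ toℕ i + 1); this shift
-- preserves all order relations and differences used below.

iter : ∀ {n} → Permutation′ n → ℕ → Fin n → Fin n
iter σ zero    i = i
iter σ (suc k) i = σ ⟨$⟩ʳ (iter σ k i)

IsNCycle : ∀ {n} → Permutation′ n → Set
IsNCycle {n} σ = ∀ (i j : Fin n) → ∃ λ k → iter σ k i ≡ j

MovesFar : ∀ {n} → Permutation′ n → Fin n → Set
MovesFar σ i = 2 ≤ ℕ.∣ toℕ (σ ⟨$⟩ʳ i) - toℕ i ∣

IsCPair : ∀ {n} → Permutation′ n → Fin n × Fin n → Set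
IsCPair σ (i , j) =
  (toℕ i < toℕ j × toℕ j < toℕ (σ ⟨$⟩ʳ i) × toℕ (σ ⟨$⟩ʳ i) < toℕ (σ ⟨$⟩ʳ j))
  ⊎ (toℕ j < toℕ i × toℕ (σ ⟨$⟩ʳ i) < toℕ j × toℕ (σ ⟨$⟩ʳ j) < toℕ (σ ⟨$⟩ʳ i))

isCPair? : ∀ {n} (σ : Permutation′ n) (p : Fin n × Fin n) → Dec (IsCPair σ p)
isCPair? σ (i , j) =
  (toℕ i ℕ.<? toℕ j ×-dec (toℕ j ℕ.<? toℕ (σ ⟨$⟩ʳ i) ×-dec toℕ (σ ⟨$⟩ʳ i) ℕ.<? toℕ (σ ⟨$⟩ʳ j)))
  ⊎-dec (toℕ j ℕ.<? toℕ i ×-dec (toℕ (σ ⟨$⟩ʳ i) ℕ.<? toℕ j ×-dec toℕ (σ ⟨$⟩ʳ j) ℕ.<? toℕ (σ ⟨$⟩ʳ i)))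

IsUR : ∀ {n} → Permutation′ n → Fin n → Set
IsUR σ i = toℕ (σ ⟨$⟩ˡ i) < toℕ i × toℕ (σ ⟨$⟩ʳ i) < toℕ i

isUR? : ∀ {n} (σ : Permutation′ n) (i : Fin n) → Dec (IsUR σ i)
isUR? σ i = toℕ (σ ⟨$⟩ˡ i) ℕ.<? toℕ i ×-dec toℕ (σ ⟨$⟩ʳ i) ℕ.<? toℕ i

numCPairs : ∀ {n} → Permutation′ n → ℕ
numCPairs {n} σ = length (filter (isCPair? σ) (cartesianProduct (allFin n) (allFin n)))

numUR : ∀ {n} → Permutation′ n → ℕ
numUR {n} σ = length (filter (isUR? σ) (allFin n))

module Submission where

-- Number the points 0, …, n-1 and induct on n over all n-cycles, tracking the
-- defect #UR − #C. Deleting the maximum M from the cycle (a → M → b becomes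
-- a → b) loses the UR-index M. Comparing the C-pairs through a and M before and
-- after, and using that a permutation has as many arcs jumping up over any
-- threshold as jumping down, gives C(σ′) + UR(σ) + 2K ≤ C(σ) + UR(σ′), where K
-- counts the arcs of σ′ enclosing the new arc a → b. Hence the defect is at most
-- one, and a defect of one is witnessed by a step x → x ± 1 that survives every
-- reinsertion of a maximum (the 2-cycle is the base case). Such steps are ruled
-- out by |σ(i) − i| ≥ 2.

open import Defs
open import Data.Nat using (ℕ; _≤_)
open import Data.Fin using (Fin)
open import Data.Fin.Permutation using (Permutation′)

open import Data.Empty using (⊥; ⊥-elim)
import Data.Fin as Fin
open import Data.Fin using (toℕ; fromℕ<)
open import Data.Fin.Permutation using (_⟨$⟩ʳ_; _⟨$⟩ˡ_; inverseˡ; inverseʳ)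
open import Data.Fin.Properties using (toℕ<n; fromℕ<-toℕ; toℕ-fromℕ<)
open import Data.List using (List; []; _∷_; _++_; length; filter; map; tabulate; cartesianProduct; allFin)
open import Data.List.Properties using (map-++; map-∘; map-tabulate)
open import Data.Nat hiding (_≤_)
open import Data.Nat.ListAction using (sum)
open import Data.Nat.ListAction.Properties using (sum-++)
open import Data.Nat.Properties
open import Algebra.Properties.CommutativeSemigroup +-commutativeSemigroup
  using (interchange; xy∙z≈xz∙y)
open import Data.Nat.Tactic.RingSolver using (solve-∀)
open import Data.Product using (_×_; _,_; ∃; proj₁; proj₂; swap)
open import Data.Sum using (_⊎_; inj₁; inj₂; [_,_])
open import Function using (_∘_)
open import Level using (Level)
open import Relation.Binary using (tri<; tri≈; tri>)
open import Relation.Binary.PropositionalEquality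
  using (_≡_; _≢_; refl; sym; trans; cong; cong₂; subst; subst₂; module ≡-Reasoning)
open import Relation.Nullary using (Dec; yes; no; ¬_)
open import Relation.Nullary.Decidable using (_×-dec_; _⊎-dec_)
open import Relation.Unary using (Decidable)

private
  variable
    ℓ ℓ′ ℓ″ : Level
    P : Set ℓ
    Q : Set ℓ′
    R : Set ℓ″

𝟙 : Dec P → ℕ
𝟙 (yes _) = 1
𝟙 (no _)  = 0

𝟙-yes : (d : Dec P) → P → 𝟙 d ≡ 1
𝟙-yes (yes _) _ = refl
𝟙-yes (no ¬p) x = ⊥-elim (¬p x)

𝟙-no : (d : Dec P) → ¬ P → 𝟙 d ≡ 0
𝟙-no (yes x) ¬p = ⊥-elim (¬p x)
𝟙-no (no _)  _  = refl

𝟙-mono : (P → Q) → (d : Dec P) (e : Dec Q) → 𝟙 d ≤ 𝟙 e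
𝟙-mono f (yes x) e = ≤-reflexive (sym (𝟙-yes e (f x)))
𝟙-mono f (no _)  e = z≤n

𝟙-cong : (P → Q) → (Q → P) → (d : Dec P) (e : Dec Q) → 𝟙 d ≡ 𝟙 e
𝟙-cong f g d e = ≤-antisym (𝟙-mono f d e) (𝟙-mono g e d)

𝟙-disjoint-+ : (P → Q → ⊥) → (P → R) → (Q → R) → (d : Dec P) (e : Dec Q) (e′ : Dec R) →
               𝟙 d + 𝟙 e ≤ 𝟙 e′
𝟙-disjoint-+ p∩q p⊆r q⊆r (yes x) (yes y) e′ = ⊥-elim (p∩q x y)
𝟙-disjoint-+ p∩q p⊆r q⊆r (yes x) (no _)  e′ = ≤-reflexive (sym (𝟙-yes e′ (p⊆r x)))
𝟙-disjoint-+ p∩q p⊆r q⊆r (no _)  (yes y) e′ = ≤-reflexive (sym (𝟙-yes e′ (q⊆r y)))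
𝟙-disjoint-+ p∩q p⊆r q⊆r (no _)  (no _)  e′ = z≤n

𝟙-partition : (Q → R → ⊥) → (¬ Q → R) → (d : Dec P) (e : Dec Q) (e′ : Dec R) →
              𝟙 d ≡ 𝟙 (d ×-dec e) + 𝟙 (d ×-dec e′)
𝟙-partition q∩r q∪r d (yes q) e′ = begin
  𝟙 d                            ≡⟨ 𝟙-cong (_, q) proj₁ d (d ×-dec yes q) ⟩
  𝟙 (d ×-dec yes q)              ≡⟨ +-identityʳ _ ⟨
  𝟙 (d ×-dec yes q) + 0          ≡⟨ cong (𝟙 (d ×-dec yes q) +_) (𝟙-no (d ×-dec e′) (q∩r q ∘ proj₂)) ⟨
  𝟙 (d ×-dec yes q) + 𝟙 (d ×-dec e′) ∎
  where open ≡-Reasoning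
𝟙-partition q∩r q∪r d (no ¬q) e′ = begin
  𝟙 d                            ≡⟨ 𝟙-cong (_, q∪r ¬q) proj₁ d (d ×-dec e′) ⟩
  𝟙 (d ×-dec e′)                 ≡⟨ cong (_+ 𝟙 (d ×-dec e′)) (𝟙-no (d ×-dec no ¬q) (¬q ∘ proj₂)) ⟨
  𝟙 (d ×-dec no ¬q) + 𝟙 (d ×-dec e′) ∎
  where open ≡-Reasoning

∑< : ℕ → (ℕ → ℕ) → ℕ
∑< zero    h = 0
∑< (suc n) h = ∑< n h + h n

syntax ∑< n (λ i → e) = ∑[ i < n ] e

∑-cong : ∀ n {h h′ : ℕ → ℕ} → (∀ i → i < n → h i ≡ h′ i) → ∑< n h ≡ ∑< n h′
∑-cong zero    eq = refl
∑-cong (suc n) eq = cong₂ _+_ (∑-cong n (λ i i<n → eq i (m<n⇒m<1+n i<n))) (eq n ≤-refl)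

∑-mono : ∀ n {h h′ : ℕ → ℕ} → (∀ i → i < n → h i ≤ h′ i) → ∑< n h ≤ ∑< n h′
∑-mono zero    le = z≤n
∑-mono (suc n) le = +-mono-≤ (∑-mono n (λ i i<n → le i (m<n⇒m<1+n i<n))) (le n ≤-refl)

∑-distrib-+ : ∀ n (h h′ : ℕ → ℕ) → ∑[ i < n ] (h i + h′ i) ≡ ∑< n h + ∑< n h′
∑-distrib-+ zero    h h′ = refl
∑-distrib-+ (suc n) h h′ = trans (cong (_+ (h n + h′ n)) (∑-distrib-+ n h h′))
                                 (interchange (∑< n h) (∑< n h′) (h n) (h′ n))

∑-unfoldˡ : ∀ n (h : ℕ → ℕ) → ∑< (suc n) h ≡ h 0 + ∑[ i < n ] h (suc i)
∑-unfoldˡ zero    h = +-comm 0 (h 0)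
∑-unfoldˡ (suc n) h = trans (cong (_+ h (suc n)) (∑-unfoldˡ n h))
                            (+-assoc (h 0) (∑[ i < n ] h (suc i)) (h (suc n)))

∑-zero : ∀ n {h : ℕ → ℕ} → (∀ i → i < n → h i ≡ 0) → ∑< n h ≡ 0
∑-zero zero    eq = refl
∑-zero (suc n) eq = cong₂ _+_ (∑-zero n (λ i i<n → eq i (m<n⇒m<1+n i<n))) (eq n ≤-refl)

term≤∑ : ∀ n (h : ℕ → ℕ) {a} → a < n → h a ≤ ∑< n h
term≤∑ (suc n) h {a} a<1+n with a ≟ n
... | yes refl = m≤n+m (h n) (∑< n h)
... | no  a≢n  = ≤-trans (term≤∑ n h (≤∧≢⇒< (≤-pred a<1+n) a≢n)) (m≤m+n (∑< n h) (h n))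

∑-exchange-at : ∀ n (h h′ : ℕ → ℕ) {a} → a < n → (∀ i → i < n → i ≢ a → h i ≡ h′ i) →
                ∑< n h + h′ a ≡ ∑< n h′ + h a
∑-exchange-at (suc n) h h′ {a} a<1+n eq with a ≟ n
... | yes refl = begin
  ∑< n h + h n + h′ n   ≡⟨ cong (λ s → s + h n + h′ n) (∑-cong n (λ i i<n → eq i (m<n⇒m<1+n i<n) (<⇒≢ i<n))) ⟩
  ∑< n h′ + h n + h′ n  ≡⟨ xy∙z≈xz∙y (∑< n h′) (h n) (h′ n) ⟩
  ∑< n h′ + h′ n + h n  ∎
  where open ≡-Reasoning
... | no a≢n = begin
  ∑< n h + h n + h′ a   ≡⟨ xy∙z≈xz∙y (∑< n h) (h n) (h′ a) ⟩
  ∑< n h + h′ a + h n   ≡⟨ cong₂ _+_ (∑-exchange-at n h h′ a<n (λ i i<n → eq i (m<n⇒m<1+n i<n)))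
                                     (eq n ≤-refl (a≢n ∘ sym)) ⟩
  ∑< n h′ + h a + h′ n  ≡⟨ xy∙z≈xz∙y (∑< n h′) (h a) (h′ n) ⟩
  ∑< n h′ + h′ n + h a  ∎
  where
  open ≡-Reasoning
  a<n = ≤∧≢⇒< (≤-pred a<1+n) a≢n

δ : ℕ → ℕ → ℕ → ℕ
δ c w i = 𝟙 (i ≟ c) * w

∑-δ : ∀ n {c} w → c < n → ∑< n (δ c w) ≡ w
∑-δ (suc n) {c} w c<1+n with n ≟ c
... | yes refl = trans (cong (_+ _) (∑-zero n (λ i i<n → cong (_* w) (𝟙-no (i ≟ n) (<⇒≢ i<n)))))
                       (*-identityˡ w)
... | no n≢c   = trans (cong (_+ 0) (∑-δ n w (≤∧≢⇒< (≤-pred c<1+n) (n≢c ∘ sym)))) (+-identityʳ w)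

-- Permutations of [0, n) are modelled by mutually inverse maps ℕ → ℕ, so that
-- deleting a point from a cycle is just bypass.
record Inverses (n : ℕ) (f g : ℕ → ℕ) : Set where
  field
    f-bound : ∀ i → i < n → f i < n
    g-bound : ∀ i → i < n → g i < n
    g∘f≗id  : ∀ i → i < n → g (f i) ≡ i
    f∘g≗id  : ∀ i → i < n → f (g i) ≡ i

Inverses-sym : ∀ {n f g} → Inverses n f g → Inverses n g f
Inverses-sym p = record
  { f-bound = g-bound ; g-bound = f-bound ; g∘f≗id = f∘g≗id ; f∘g≗id = g∘f≗id }
  where open Inverses p

bypass : ℕ → (ℕ → ℕ) → ℕ → ℕ
bypass M f i with f i ≟ M
... | yes _ = f M
... | no  _ = f i

bypass-hit : ∀ M f {i} → f i ≡ M → bypass M f i ≡ f M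
bypass-hit M f {i} fi≡M with f i ≟ M
... | yes _    = refl
... | no fi≢M  = ⊥-elim (fi≢M fi≡M)

bypass-miss : ∀ M f {i} → f i ≢ M → bypass M f i ≡ f i
bypass-miss M f {i} fi≢M with f i ≟ M
... | yes fi≡M = ⊥-elim (fi≢M fi≡M)
... | no _     = refl

module Bypass {M f g} (p : Inverses (suc M) f g) where
  open Inverses p

  bound : ∀ i → i < M → bypass M f i < M
  bound i i<M with f i ≟ M
  ... | yes fi≡M = ≤∧≢⇒< (≤-pred (f-bound M ≤-refl)) fM≢M
    where
    gM≡i : g M ≡ i
    gM≡i = trans (cong g (sym fi≡M)) (g∘f≗id i (m<n⇒m<1+n i<M))
    fM≢M : f M ≢ M
    fM≢M fM≡M = <⇒≢ i<M (trans (sym gM≡i) (trans (cong g (sym fM≡M)) (g∘f≗id M ≤-refl)))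
  ... | no fi≢M = ≤∧≢⇒< (≤-pred (f-bound i (m<n⇒m<1+n i<M))) fi≢M

  inverse : ∀ i → i < M → bypass M g (bypass M f i) ≡ i
  inverse i i<M with f i ≟ M
  ... | yes fi≡M = begin
    bypass M g (f M)  ≡⟨ bypass-hit M g (g∘f≗id M ≤-refl) ⟩
    g M               ≡⟨ cong g fi≡M ⟨
    g (f i)           ≡⟨ g∘f≗id i (m<n⇒m<1+n i<M) ⟩
    i                 ∎
    where open ≡-Reasoning
  ... | no _ = trans (bypass-miss M g (λ gfi≡M → <⇒≢ i<M (trans (sym gfi) gfi≡M))) gfi
    where
    gfi : g (f i) ≡ i
    gfi = g∘f≗id i (m<n⇒m<1+n i<M)

bypass-inverses : ∀ {M f g} → Inverses (suc M) f g → Inverses M (bypass M f) (bypass M g)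
bypass-inverses p = record
  { f-bound = Bypass.bound p ; g-bound = Bypass.bound (Inverses-sym p)
  ; g∘f≗id = Bypass.inverse p ; f∘g≗id = Bypass.inverse (Inverses-sym p) }

∑-reindex : ∀ n {f g} → Inverses n f g → ∀ h → ∑[ i < n ] h (f i) ≡ ∑< n h
∑-reindex zero    p h = refl
∑-reindex (suc M) {f} {g} p h with g M ≟ M
... | yes gM≡M = cong₂ _+_ (trans (∑-cong M (λ i i<M → cong h (sym (bypass-miss M f (fi≢M i i<M)))))
                                  (∑-reindex M (bypass-inverses p) h))
                           (cong h fM≡M)
  where
  open Inverses p
  fM≡M : f M ≡ M
  fM≡M = trans (cong f (sym gM≡M)) (f∘g≗id M ≤-refl)
  fi≢M : ∀ i → i < M → f i ≢ M
  fi≢M i i<M fi≡M = <⇒≢ i<M (trans (sym (g∘f≗id i (m<n⇒m<1+n i<M))) (trans (cong g fi≡M) gM≡M))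
... | no gM≢M = begin
  ∑[ i < M ] h (f i) + h (f M)             ≡⟨ cong (λ x → ∑[ i < M ] h (f i) + h x) (bypass-hit M f faM) ⟨
  ∑[ i < M ] h (f i) + h (bypass M f a)    ≡⟨ ∑-exchange-at M (h ∘ f) (h ∘ bypass M f) a<M
                                                (λ i i<M i≢a → cong h (sym (bypass-miss M f (i≢a ∘ fi≡M⇒i≡a i i<M)))) ⟩
  ∑[ i < M ] h (bypass M f i) + h (f a)    ≡⟨ cong₂ _+_ (∑-reindex M (bypass-inverses p) h) (cong h faM) ⟩
  ∑< M h + h M                             ∎
  where
  open ≡-Reasoning
  open Inverses p
  a = g M
  a<M : a < M
  a<M = ≤∧≢⇒< (≤-pred (g-bound M ≤-refl)) gM≢M
  faM : f a ≡ M
  faM = f∘g≗id M ≤-refl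
  fi≡M⇒i≡a : ∀ i → i < M → f i ≡ M → i ≡ a
  fi≡M⇒i≡a i i<M fi≡M = trans (sym (g∘f≗id i (m<n⇒m<1+n i<M))) (cong g fi≡M)

-- Both sides equal the number of i < t minus the number of i < t with f i < t.
upcrossings≡downcrossings : ∀ n {f g} → Inverses n f g → ∀ t →
  ∑[ i < n ] 𝟙 (i <? t ×-dec t ≤? f i) ≡ ∑[ i < n ] 𝟙 (f i <? t ×-dec t ≤? i)
upcrossings≡downcrossings n {f} p t = +-cancelˡ-≡ stay _ _ (begin
  stay + up                                                ≡⟨ ∑-distrib-+ n _ _ ⟨
  ∑[ i < n ] (𝟙 (i <? t ×-dec f i <? t) + 𝟙 (i <? t ×-dec t ≤? f i))
                                                           ≡⟨ ∑-cong n (λ i _ → split (i <? t) (f i) ) ⟨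
  ∑[ i < n ] 𝟙 (i <? t)                                    ≡⟨ ∑-reindex n p (λ j → 𝟙 (j <? t)) ⟨
  ∑[ i < n ] 𝟙 (f i <? t)                                  ≡⟨ ∑-cong n (λ i _ → split (f i <? t) i) ⟩
  ∑[ i < n ] (𝟙 (f i <? t ×-dec i <? t) + 𝟙 (f i <? t ×-dec t ≤? i))
                                                           ≡⟨ ∑-distrib-+ n _ _ ⟩
  stay′ + down                                             ≡⟨ cong (_+ down) (∑-cong n (λ i _ → 𝟙-cong swap swap _ _)) ⟩
  stay + down                                              ∎)
  where
  open ≡-Reasoning
  split : ∀ {p} {P : Set p} (d : Dec P) x → 𝟙 d ≡ 𝟙 (d ×-dec x <? t) + 𝟙 (d ×-dec t ≤? x)
  split d x = 𝟙-partition <⇒≱ ≮⇒≥ d (x <? t) (t ≤? x)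
  stay stay′ up down : ℕ
  stay  = ∑[ i < n ] 𝟙 (i <? t ×-dec f i <? t)
  stay′ = ∑[ i < n ] 𝟙 (f i <? t ×-dec i <? t)
  up    = ∑[ i < n ] 𝟙 (i <? t ×-dec t ≤? f i)
  down  = ∑[ i < n ] 𝟙 (f i <? t ×-dec t ≤? i)

CPairPattern : ℕ → ℕ → ℕ → ℕ → Set
CPairPattern i j x y = (i < j × j < x × x < y) ⊎ (j < i × x < j × y < x)

cPairPattern? : ∀ i j x y → Dec (CPairPattern i j x y)
cPairPattern? i j x y =
  (i <? j ×-dec (j <? x ×-dec x <? y)) ⊎-dec (j <? i ×-dec (x <? j ×-dec y <? x))

cPair : (ℕ → ℕ) → ℕ → ℕ → ℕ
cPair f i j = 𝟙 (cPairPattern? i j (f i) (f j))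

cRow cCol : ℕ → (ℕ → ℕ) → ℕ → ℕ
cRow n f a = ∑[ j < n ] cPair f a j
cCol n f a = ∑[ i < n ] cPair f i a

cPairs : ℕ → (ℕ → ℕ) → ℕ
cPairs n f = ∑[ i < n ] cRow n f i

urIndex : (ℕ → ℕ) → (ℕ → ℕ) → ℕ → ℕ
urIndex f g i = 𝟙 (g i <? i ×-dec f i <? i)

urIndices : ℕ → (ℕ → ℕ) → (ℕ → ℕ) → ℕ
urIndices n f g = ∑< n (urIndex f g)

cPair-diag : ∀ f i → cPair f i i ≡ 0
cPair-diag f i = 𝟙-no (cPairPattern? i i (f i) (f i)) λ
  { (inj₁ (i<i , _)) → <-irrefl refl i<i
  ; (inj₂ (i<i , _)) → <-irrefl refl i<i }

cPairs-suc-≥ : ∀ n f → cPairs n f + cRow n f n ≤ cPairs (suc n) f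
cPairs-suc-≥ n f = +-mono-≤ (∑-mono n (λ i _ → m≤m+n (cRow n f i) (cPair f i n)))
                            (m≤m+n (cRow n f n) (cPair f n n))

∑²-exchange-at : ∀ M (F F′ : ℕ → ℕ → ℕ) {a} → a < M →
  (∀ i j → i < M → j < M → i ≢ a → j ≢ a → F i j ≡ F′ i j) → F a a ≡ F′ a a →
  ∑[ i < M ] ∑< M (F i) + ∑< M (F′ a) + ∑[ i < M ] F′ i a
    ≡ ∑[ i < M ] ∑< M (F′ i) + ∑< M (F a) + ∑[ i < M ] F i a
∑²-exchange-at M F F′ {a} a<M eq eqa = +-cancelʳ-≡ (F a a) _ _ (begin
  ∑² F + ∑< M (F′ a) + colF′ + F a a    ≡⟨ shuffle (∑² F) (∑< M (F′ a)) colF′ (F a a) ⟩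
  (∑² F + colF′) + (∑< M (F′ a) + F a a) ≡⟨ cong (_+ (∑< M (F′ a) + F a a)) (∑-distrib-+ M _ _) ⟨
  ∑< M H + H′ a                         ≡⟨ ∑-exchange-at M H H′ a<M (λ i i<M i≢a →
                                             ∑-exchange-at M (F i) (F′ i) a<M (λ j j<M j≢a → eq i j i<M j<M i≢a j≢a)) ⟩
  ∑< M H′ + H a                         ≡⟨ cong₂ _+_ (∑-distrib-+ M _ _) (cong (∑< M (F a) +_) (sym eqa)) ⟩
  (∑² F′ + colF) + (∑< M (F a) + F a a) ≡⟨ shuffle (∑² F′) (∑< M (F a)) colF (F a a) ⟨
  ∑² F′ + ∑< M (F a) + colF + F a a     ∎)
  where
  open ≡-Reasoning
  ∑² : (ℕ → ℕ → ℕ) → ℕ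
  ∑² G = ∑[ i < M ] ∑< M (G i)
  colF colF′ : ℕ
  colF  = ∑[ i < M ] F i a
  colF′ = ∑[ i < M ] F′ i a
  H H′ : ℕ → ℕ
  H  i = ∑< M (F i)  + F′ i a
  H′ i = ∑< M (F′ i) + F i a
  shuffle : ∀ w x y z → w + x + y + z ≡ (w + y) + (x + z)
  shuffle = solve-∀

cPairs-exchange-at : ∀ M f f′ {a} → a < M → (∀ i → i < M → i ≢ a → f i ≡ f′ i) →
  cPairs M f + cRow M f′ a + cCol M f′ a ≡ cPairs M f′ + cRow M f a + cCol M f a
cPairs-exchange-at M f f′ a<M agree = ∑²-exchange-at M (cPair f) (cPair f′) a<M
  (λ i j i<M j<M i≢a j≢a → cong₂ (λ x y → 𝟙 (cPairPattern? i j x y)) (agree i i<M i≢a) (agree j j<M j≢a))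
  (trans (cPair-diag f _) (sym (cPair-diag f′ _)))

Enclosed : ℕ → (ℕ → ℕ) → ℕ → Set
Enclosed n f x = ∃ λ i → i < n × ((x < f x × i < x × f x < f i) ⊎ (f x < x × x < i × f i < f x))

<-cyclic : ∀ {x y z} {A : Set} → x < y → y < z → z < x → A
<-cyclic x<y y<z z<x = ⊥-elim (<-asym (<-trans x<y y<z) z<x)

module DeleteMax {M f g} (p : Inverses (suc M) f g)
                 (a<M : g M < M) (b<M : f M < M) (a≢b : g M ≢ f M) where
  open Inverses p

  a b : ℕ
  a = g M
  b = f M

  f′ g′ : ℕ → ℕ
  f′ = bypass M f
  g′ = bypass M g

  fa≡M : f a ≡ M
  fa≡M = f∘g≗id M ≤-refl

  gb≡M : g b ≡ M
  gb≡M = g∘f≗id M ≤-refl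

  f′a≡b : f′ a ≡ b
  f′a≡b = bypass-hit M f fa≡M

  g′b≡a : g′ b ≡ a
  g′b≡a = bypass-hit M g gb≡M

  fi≡M⇒i≡a : ∀ i → i < suc M → f i ≡ M → i ≡ a
  fi≡M⇒i≡a i i<1+M fi≡M = trans (sym (g∘f≗id i i<1+M)) (cong g fi≡M)

  gi≡M⇒i≡b : ∀ i → i < suc M → g i ≡ M → i ≡ b
  gi≡M⇒i≡b i i<1+M gi≡M = trans (sym (f∘g≗id i i<1+M)) (cong f gi≡M)

  f′-agrees : ∀ i → i < M → i ≢ a → f′ i ≡ f i
  f′-agrees i i<M i≢a = bypass-miss M f (i≢a ∘ fi≡M⇒i≡a i (m<n⇒m<1+n i<M))

  g′-agrees : ∀ i → i < M → i ≢ b → g′ i ≡ g i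
  g′-agrees i i<M i≢b = bypass-miss M g (i≢b ∘ gi≡M⇒i≡b i (m<n⇒m<1+n i<M))

  fi<M : ∀ i → i < M → i ≢ a → f i < M
  fi<M i i<M i≢a = ≤∧≢⇒< (≤-pred (f-bound i (m<n⇒m<1+n i<M))) (i≢a ∘ fi≡M⇒i≡a i (m<n⇒m<1+n i<M))

  M-is-urIndex : urIndices (suc M) f g ≡ urIndices M f g + 1
  M-is-urIndex = cong (urIndices M f g +_) (𝟙-yes (g M <? M ×-dec f M <? M) (a<M , b<M))

  a-not-urIndex : urIndex f g a ≡ 0
  a-not-urIndex = 𝟙-no (g a <? a ×-dec f a <? a) (λ (_ , fa<a) → <-asym (subst (_< a) fa≡M fa<a) a<M)

  b-not-urIndex : urIndex f g b ≡ 0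
  b-not-urIndex = 𝟙-no (g b <? b ×-dec f b <? b) (λ (gb<b , _) → <-asym (subst (_< b) gb≡M gb<b) b<M)

  urIndex-≤ : ∀ i → i < M → urIndex f g i ≤ urIndex f′ g′ i
  urIndex-≤ i i<M with i ≟ a | i ≟ b
  ... | yes refl | _        = ≤-trans (≤-reflexive a-not-urIndex) z≤n
  ... | no _     | yes refl = ≤-trans (≤-reflexive b-not-urIndex) z≤n
  ... | no i≢a   | no i≢b   =
    ≤-reflexive (cong₂ (λ x y → 𝟙 (x <? i ×-dec y <? i)) (sym (g′-agrees i i<M i≢b)) (sym (f′-agrees i i<M i≢a)))

  cPairs-exchange : cPairs M f + cRow M f′ a + cCol M f′ a ≡ cPairs M f′ + cRow M f a + cCol M f a
  cPairs-exchange = cPairs-exchange-at M f f′ a<M (λ i i<M i≢a → sym (f′-agrees i i<M i≢a))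

  U U′ row col row′ col′ rowM : ℕ
  U    = urIndices M f g
  U′   = urIndices M f′ g′
  row  = cRow M f a
  col  = cCol M f a
  row′ = cRow M f′ a
  col′ = cCol M f′ a
  rowM = cRow M f M

  Budget : ℕ → Set
  Budget K = 2 * K + row′ + col′ + U + 1 ≤ row + col + rowM + U′

  budget⇒bound : ∀ {K} → Budget K →
    cPairs M f′ + urIndices (suc M) f g + 2 * K ≤ cPairs (suc M) f + urIndices M f′ g′
  budget⇒bound {K} budget = +-cancelʳ-≤ (row′ + col′) _ _ (begin
    C′ + urIndices (suc M) f g + 2 * K + (row′ + col′) ≡⟨ cong (λ u → C′ + u + 2 * K + (row′ + col′)) M-is-urIndex ⟩
    C′ + (U + 1) + 2 * K + (row′ + col′)               ≡⟨ shuffle₁ C′ U K row′ col′ ⟩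
    C′ + (2 * K + row′ + col′ + U + 1)                 ≤⟨ +-monoʳ-≤ C′ budget ⟩
    C′ + (row + col + rowM + U′)                       ≡⟨ shuffle₂ C′ row col rowM U′ ⟩
    (C′ + row + col) + rowM + U′                       ≡⟨ cong (λ x → x + rowM + U′) cPairs-exchange ⟨
    (cPairs M f + row′ + col′) + rowM + U′             ≡⟨ shuffle₃ (cPairs M f) row′ col′ rowM U′ ⟩
    (cPairs M f + rowM) + U′ + (row′ + col′)           ≤⟨ +-monoˡ-≤ (row′ + col′) (+-monoˡ-≤ U′ (cPairs-suc-≥ M f)) ⟩
    cPairs (suc M) f + U′ + (row′ + col′)              ∎)
    where
    open ≤-Reasoning
    C′ : ℕ
    C′ = cPairs M f′
    shuffle₁ : ∀ C U K r c → C + (U + 1) + 2 * K + (r + c) ≡ C + (2 * K + r + c + U + 1)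
    shuffle₁ = solve-∀
    shuffle₂ : ∀ C r c Z U → C + (r + c + Z + U) ≡ C + r + c + Z + U
    shuffle₂ = solve-∀
    shuffle₃ : ∀ D r c Z U → D + r + c + Z + U ≡ D + Z + U + (r + c)
    shuffle₃ = solve-∀

  module Upward (a<b : a < b) where
    enclosing up down : ℕ → ℕ
    enclosing i = 𝟙 (i <? a ×-dec b <? f′ i)
    up   i = 𝟙 (i <? b ×-dec b ≤? f i)
    down i = 𝟙 (f i <? b ×-dec b ≤? i)

    K : ℕ
    K = ∑< M enclosing

    enclosing-a : enclosing a ≡ 0
    enclosing-a = 𝟙-no (a <? a ×-dec b <? f′ a) (λ (a<a , _) → <-irrefl refl a<a)

    row′-bound : ∀ i → i < M → δ a 1 i + cPair f′ a i + enclosing i ≤ up i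
    row′-bound i i<M with i ≟ a
    ... | yes refl rewrite cPair-diag f′ a | enclosing-a
                         | 𝟙-yes (a <? b ×-dec b ≤? f a) (a<b , subst (b ≤_) (sym fa≡M) (<⇒≤ b<M)) = ≤-refl
    ... | no i≢a rewrite f′-agrees i i<M i≢a | f′a≡b = 𝟙-disjoint-+
      (λ { (inj₁ (a<i , _)) (i<a , _) → <-asym a<i i<a ; (inj₂ (i<a , b<i , _)) _ → <-cyclic b<i i<a a<b })
      (λ { (inj₁ (a<i , i<b , b<fi)) → i<b , <⇒≤ b<fi ; (inj₂ (i<a , b<i , _)) → <-cyclic b<i i<a a<b })
      (λ (i<a , b<fi) → <-trans i<a a<b , <⇒≤ b<fi)
      (cPairPattern? a i b (f i)) (i <? a ×-dec b <? f i) (i <? b ×-dec b ≤? f i)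

    col′-bound : ∀ i → i < M → cPair f′ i a + enclosing i ≤ cPair f i a
    col′-bound i i<M with i ≟ a
    ... | yes refl rewrite cPair-diag f′ a | enclosing-a = z≤n
    ... | no i≢a rewrite f′-agrees i i<M i≢a | f′a≡b | fa≡M = 𝟙-disjoint-+
      (λ { (inj₁ (_ , _ , fi<b)) (_ , b<fi) → <-asym fi<b b<fi ; (inj₂ (a<i , _)) (i<a , _) → <-asym a<i i<a })
      (λ { (inj₁ (i<a , a<fi , _)) → inj₁ (i<a , a<fi , fi<M i i<M i≢a) ; (inj₂ (_ , fi<a , b<fi)) → <-cyclic fi<a a<b b<fi })
      (λ (i<a , b<fi) → inj₁ (i<a , <-trans a<b b<fi , fi<M i i<M i≢a))
      (cPairPattern? i a (f i) b) (i <? a ×-dec b <? f i) (cPairPattern? i a (f i) M)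

    down-bound : ∀ i → i < M → down i + urIndex f g i ≤ cPair f M i + urIndex f′ g′ i
    down-bound i i<M with i ≟ b
    ... | yes refl rewrite b-not-urIndex | +-identityʳ (down b) = ≤-trans
      (𝟙-mono (λ (fb<b , _) → subst (_< b) (sym g′b≡a) a<b , subst (_< b) (sym (f′-agrees b b<M (a≢b ∘ sym))) fb<b)
              (f b <? b ×-dec b ≤? b) (g′ b <? b ×-dec f′ b <? b))
      (m≤n+m _ _)
    ... | no i≢b = +-mono-≤
      (𝟙-mono (λ (fi<b , b≤i) → inj₂ (i<M , ≤∧≢⇒< b≤i (i≢b ∘ sym) , fi<b))
              (f i <? b ×-dec b ≤? i) (cPairPattern? M i b (f i)))
      (urIndex-≤ i i<M)

    up≡down : ∑< M up ≡ ∑< M down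
    up≡down = +-cancelʳ-≡ 0 _ _ (subst₂ (λ x y → ∑< M up + x ≡ ∑< M down + y)
      (𝟙-no (M <? b ×-dec b ≤? f M) (λ (M<b , _) → <-asym M<b b<M))
      (𝟙-no (f M <? b ×-dec b ≤? M) (λ (b<b , _) → <-irrefl refl b<b))
      (upcrossings≡downcrossings (suc M) p b))

    ∑row′-bound : 1 + row′ + K ≤ ∑< M up
    ∑row′-bound = begin
      1 + row′ + K                                      ≡⟨ cong (λ x → x + row′ + K) (∑-δ M 1 a<M) ⟨
      ∑< M (δ a 1) + row′ + K                           ≡⟨ cong (_+ K) (∑-distrib-+ M _ _) ⟨
      ∑[ i < M ] (δ a 1 i + cPair f′ a i) + K           ≡⟨ ∑-distrib-+ M _ _ ⟨
      ∑[ i < M ] (δ a 1 i + cPair f′ a i + enclosing i) ≤⟨ ∑-mono M row′-bound ⟩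
      ∑< M up                                           ∎
      where open ≤-Reasoning

    ∑col′-bound : col′ + K ≤ col
    ∑col′-bound = ≤-trans (≤-reflexive (sym (∑-distrib-+ M _ _))) (∑-mono M col′-bound)

    ∑down-bound : ∑< M down + U ≤ rowM + U′
    ∑down-bound = begin
      ∑< M down + U                                  ≡⟨ ∑-distrib-+ M _ _ ⟨
      ∑[ i < M ] (down i + urIndex f g i)            ≤⟨ ∑-mono M down-bound ⟩
      ∑[ i < M ] (cPair f M i + urIndex f′ g′ i)     ≡⟨ ∑-distrib-+ M _ _ ⟩
      rowM + U′                                      ∎
      where open ≤-Reasoning

    budget : Budget K
    budget = begin
      2 * K + row′ + col′ + U + 1      ≡⟨ shuffle₁ K row′ col′ U ⟩
      (1 + row′ + K) + (col′ + K) + U  ≤⟨ +-monoˡ-≤ U (+-mono-≤ ∑row′-bound ∑col′-bound) ⟩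
      ∑< M up + col + U                ≡⟨ cong (λ x → x + col + U) up≡down ⟩
      ∑< M down + col + U              ≡⟨ xy∙z≈xz∙y (∑< M down) col U ⟩
      ∑< M down + U + col              ≤⟨ +-monoˡ-≤ col ∑down-bound ⟩
      rowM + U′ + col                  ≡⟨ shuffle₂ rowM U′ col ⟩
      col + rowM + U′                  ≤⟨ +-monoˡ-≤ U′ (+-monoˡ-≤ rowM (m≤n+m col row)) ⟩
      row + col + rowM + U′            ∎
      where
      open ≤-Reasoning
      shuffle₁ : ∀ K r c U → 2 * K + r + c + U + 1 ≡ (1 + r + K) + (c + K) + U
      shuffle₁ = solve-∀
      shuffle₂ : ∀ Z U c → Z + U + c ≡ c + Z + U
      shuffle₂ = solve-∀

    enclosed⇒K≥1 : Enclosed M f′ a → 1 ≤ K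
    enclosed⇒K≥1 (i , i<M , inj₁ (_ , i<a , b<f′i)) = ≤-trans
      (≤-reflexive (sym (𝟙-yes (i <? a ×-dec b <? f′ i) (i<a , subst (_< f′ i) f′a≡b b<f′i))))
      (term≤∑ M enclosing i<M)
    enclosed⇒K≥1 (i , i<M , inj₂ (f′a<a , _)) = ⊥-elim (<-asym a<b (subst (_< a) f′a≡b f′a<a))

  module Downward (b<a : b < a) where
    a₀ w : ℕ
    a₀ = g a
    w  = 𝟙 (a₀ <? a)

    enclosing up down : ℕ → ℕ
    enclosing i = 𝟙 (a <? i ×-dec f′ i <? b)
    up   i = 𝟙 (i <? a ×-dec a ≤? f i)
    down i = 𝟙 (f i <? a ×-dec a ≤? i)

    K : ℕ
    K = ∑< M enclosing

    enclosing-a : enclosing a ≡ 0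
    enclosing-a = 𝟙-no (a <? a ×-dec f′ a <? b) (λ (a<a , _) → <-irrefl refl a<a)

    a₀<M : a₀ < M
    a₀<M = ≤∧≢⇒< (≤-pred (g-bound a (m<n⇒m<1+n a<M))) (a≢b ∘ gi≡M⇒i≡b a (m<n⇒m<1+n a<M))

    up-bound : ∀ i → i < M → up i ≤ cPair f i a + δ a₀ w i
    up-bound i i<M with i ≟ a₀
    ... | yes refl = ≤-trans (𝟙-mono proj₁ (a₀ <? a ×-dec a ≤? f a₀) (a₀ <? a))
                             (≤-trans (m≤m+n w 0) (m≤n+m (w + 0) (cPair f a₀ a)))
    ... | no i≢a₀ = ≤-trans
      (𝟙-mono (λ (i<a , a≤fi) → inj₁ (i<a , ≤∧≢⇒< a≤fi (i≢a₀ ∘ fi≡a⇒i≡a₀ i i<M ∘ sym) ,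
                                      subst (f i <_) (sym fa≡M) (fi<M i i<M (<⇒≢ i<a))))
              (i <? a ×-dec a ≤? f i) (cPairPattern? i a (f i) (f a)))
      (m≤m+n _ _)
      where
      fi≡a⇒i≡a₀ : ∀ i → i < M → f i ≡ a → i ≡ a₀
      fi≡a⇒i≡a₀ i i<M fi≡a = trans (sym (g∘f≗id i (m<n⇒m<1+n i<M))) (cong g fi≡a)

    urIndex-bound : ∀ i → i < M → urIndex f g i + δ a w i ≤ urIndex f′ g′ i
    urIndex-bound i i<M with i ≟ a
    ... | yes refl rewrite a-not-urIndex | +-identityʳ w = 𝟙-mono
      (λ a₀<a → subst (_< a) (sym (g′-agrees a a<M a≢b)) a₀<a , subst (_< a) (sym f′a≡b) b<a)
      (a₀ <? a) (g′ a <? a ×-dec f′ a <? a)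
    ... | no _ rewrite +-identityʳ (urIndex f g i) = urIndex-≤ i i<M

    col′-bound : ∀ i → i < M → cPair f′ i a + enclosing i ≤ down i
    col′-bound i i<M with i ≟ a
    ... | yes refl rewrite cPair-diag f′ a | enclosing-a = z≤n
    ... | no i≢a rewrite f′-agrees i i<M i≢a | f′a≡b = 𝟙-disjoint-+
      (λ { (inj₁ (i<a , _)) (a<i , _) → <-asym a<i i<a ; (inj₂ (_ , _ , b<fi)) (_ , fi<b) → <-asym fi<b b<fi })
      (λ { (inj₁ (_ , a<fi , fi<b)) → <-cyclic a<fi fi<b b<a ; (inj₂ (a<i , fi<a , _)) → fi<a , <⇒≤ a<i })
      (λ (a<i , fi<b) → <-trans fi<b b<a , <⇒≤ a<i)
      (cPairPattern? i a (f i) b) (a <? i ×-dec f i <? b) (f i <? a ×-dec a ≤? i)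

    row′-bound : ∀ i → i < M → cPair f′ a i + enclosing i ≤ cPair f M i
    row′-bound i i<M with i ≟ a
    ... | yes refl rewrite cPair-diag f′ a | enclosing-a = z≤n
    ... | no i≢a rewrite f′-agrees i i<M i≢a | f′a≡b = 𝟙-disjoint-+
      (λ { (inj₁ (_ , _ , b<fi)) (_ , fi<b) → <-asym fi<b b<fi ; (inj₂ (i<a , _)) (a<i , _) → <-asym a<i i<a })
      (λ { (inj₁ (a<i , i<b , _)) → <-cyclic a<i i<b b<a ; (inj₂ (_ , b<i , fi<b)) → inj₂ (i<M , b<i , fi<b) })
      (λ (a<i , fi<b) → inj₂ (i<M , <-trans b<a a<i , fi<b))
      (cPairPattern? a i b (f i)) (a <? i ×-dec f i <? b) (cPairPattern? M i b (f i))

    up≡1+down : ∑< M up ≡ 1 + ∑< M down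
    up≡1+down = begin
      ∑< M up                ≡⟨ +-identityʳ _ ⟨
      ∑< M up + 0            ≡⟨ cong (∑< M up +_) (𝟙-no (M <? a ×-dec a ≤? f M) (λ (M<a , _) → <-asym M<a a<M)) ⟨
      ∑< (suc M) up          ≡⟨ upcrossings≡downcrossings (suc M) p a ⟩
      ∑< (suc M) down        ≡⟨ cong (∑< M down +_) (𝟙-yes (f M <? a ×-dec a ≤? M) (b<a , <⇒≤ a<M)) ⟩
      ∑< M down + 1          ≡⟨ +-comm _ 1 ⟩
      1 + ∑< M down          ∎
      where open ≡-Reasoning

    budget : Budget K
    budget = begin
      2 * K + row′ + col′ + U + 1                  ≡⟨ shuffle₁ K row′ col′ U ⟩
      1 + (col′ + K) + (row′ + K) + U              ≤⟨ +-monoˡ-≤ U (+-mono-≤ (+-monoʳ-≤ 1 ∑col′-bound) ∑row′-bound) ⟩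
      1 + ∑< M down + rowM + U                     ≡⟨ cong (λ x → x + rowM + U) up≡1+down ⟨
      ∑< M up + rowM + U                           ≤⟨ +-monoˡ-≤ U (+-monoˡ-≤ rowM ∑up-bound) ⟩
      col + w + rowM + U                           ≡⟨ shuffle₂ col w rowM U ⟩
      col + rowM + (U + w)                         ≤⟨ +-monoʳ-≤ (col + rowM) ∑urIndex-bound ⟩
      col + rowM + U′                              ≤⟨ +-monoˡ-≤ U′ (+-monoˡ-≤ rowM (m≤n+m col row)) ⟩
      row + col + rowM + U′                        ∎
      where
      open ≤-Reasoning
      ∑col′-bound : col′ + K ≤ ∑< M down
      ∑col′-bound = ≤-trans (≤-reflexive (sym (∑-distrib-+ M _ _))) (∑-mono M col′-bound)
      ∑row′-bound : row′ + K ≤ rowM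
      ∑row′-bound = ≤-trans (≤-reflexive (sym (∑-distrib-+ M _ _))) (∑-mono M row′-bound)
      ∑up-bound : ∑< M up ≤ col + w
      ∑up-bound = ≤-trans (∑-mono M up-bound) (≤-reflexive (trans (∑-distrib-+ M _ _) (cong (col +_) (∑-δ M w a₀<M))))
      ∑urIndex-bound : U + w ≤ U′
      ∑urIndex-bound = ≤-trans (≤-reflexive (sym (trans (∑-distrib-+ M _ _) (cong (U +_) (∑-δ M w a<M)))))
                               (∑-mono M urIndex-bound)
      shuffle₁ : ∀ K r c U → 2 * K + r + c + U + 1 ≡ 1 + (c + K) + (r + K) + U
      shuffle₁ = solve-∀
      shuffle₂ : ∀ c w Z U → c + w + Z + U ≡ c + Z + (U + w)
      shuffle₂ = solve-∀

    enclosed⇒K≥1 : Enclosed M f′ a → 1 ≤ K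
    enclosed⇒K≥1 (i , i<M , inj₁ (a<f′a , _)) = ⊥-elim (<-asym b<a (subst (a <_) f′a≡b a<f′a))
    enclosed⇒K≥1 (i , i<M , inj₂ (_ , a<i , f′i<f′a)) = ≤-trans
      (≤-reflexive (sym (𝟙-yes (a <? i ×-dec f′ i <? b) (a<i , subst (f′ i <_) f′a≡b f′i<f′a))))
      (term≤∑ M enclosing i<M)

  bound : ∃ λ K → (cPairs M f′ + urIndices (suc M) f g + 2 * K ≤ cPairs (suc M) f + urIndices M f′ g′)
                × (Enclosed M f′ a → 1 ≤ K)
  bound with <-cmp a b
  ... | tri< a<b _ _ = Upward.K a<b , budget⇒bound {Upward.K a<b} (Upward.budget a<b) , Upward.enclosed⇒K≥1 a<b
  ... | tri≈ _ a≡b _ = ⊥-elim (a≢b a≡b)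
  ... | tri> _ _ b<a = Downward.K b<a , budget⇒bound {Downward.K b<a} (Downward.budget b<a) , Downward.enclosed⇒K≥1 b<a

iterate : (ℕ → ℕ) → ℕ → ℕ → ℕ
iterate f zero    i = i
iterate f (suc k) i = f (iterate f k i)

iterate-bound : ∀ {n f g} → Inverses n f g → ∀ k {i} → i < n → iterate f k i < n
iterate-bound p zero    i<n = i<n
iterate-bound p (suc k) i<n = Inverses.f-bound p _ (iterate-bound p k i<n)

IsCycle : ℕ → (ℕ → ℕ) → Set
IsCycle n f = ∀ i j → i < n → j < n → ∃ λ k → iterate f k i ≡ j

Adjacent : ℕ → ℕ → Set
Adjacent x y = suc x ≡ y ⊎ suc y ≡ x

Adjacent⇒∣-∣≡1 : ∀ {x y} → Adjacent x y → ∣ x - y ∣ ≡ 1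
Adjacent⇒∣-∣≡1 {x} (inj₁ refl)     = trans (cong (∣ x -_∣) (+-comm 1 x)) (∣m-m+n∣≡n x 1)
Adjacent⇒∣-∣≡1 {y = y} (inj₂ refl) = trans (∣-∣-comm (suc y) y) (Adjacent⇒∣-∣≡1 {y} (inj₁ refl))

StableAdjacency : ℕ → (ℕ → ℕ) → Set
StableAdjacency n f =
  ∃ λ x → x < n × Adjacent x (f x) × (suc x ≡ n ⊎ suc (f x) ≡ n ⊎ Enclosed n f x)

URBound : ℕ → Set
URBound n = ∀ f g → Inverses n f g → IsCycle n f →
  urIndices n f g ≤ cPairs n f ⊎ (suc (cPairs n f) ≡ urIndices n f g × StableAdjacency n f)

module CycleTop {M f g} (p : Inverses (suc M) f g) (cycle : IsCycle (suc M) f) where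
  open Inverses p

  f-top≢top : 1 ≤ M → f M ≢ M
  f-top≢top 1≤M fM≡M with cycle M 0 ≤-refl (s≤s z≤n)
  ... | k , reaches0 = <⇒≢ 1≤M (trans (sym reaches0) (stuck k))
    where
    stuck : ∀ k → iterate f k M ≡ M
    stuck zero    = refl
    stuck (suc k) = trans (cong f (stuck k)) fM≡M

  g-top≢top : 1 ≤ M → g M ≢ M
  g-top≢top 1≤M gM≡M = f-top≢top 1≤M (trans (cong f (sym gM≡M)) (f∘g≗id M ≤-refl))

  g-top≢f-top : 2 ≤ M → g M ≢ f M
  g-top≢f-top 2≤M gM≡fM = third-point (f M ≟ 0)
    where
    ffM≡M : f (f M) ≡ M
    ffM≡M = trans (cong f (sym gM≡fM)) (f∘g≗id M ≤-refl)
    orbit : ∀ k → iterate f k M ≡ M ⊎ iterate f k M ≡ f M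
    orbit zero = inj₁ refl
    orbit (suc k) with orbit k
    ... | inj₁ e = inj₂ (cong f e)
    ... | inj₂ e = inj₁ (trans (cong f e) ffM≡M)
    unreachable : ∀ t → t < suc M → t ≢ M → t ≢ f M → ⊥
    unreachable t t<1+M t≢M t≢fM with cycle M t ≤-refl t<1+M
    ... | k , reaches = [ (λ e → t≢M (trans (sym reaches) e)) , (λ e → t≢fM (trans (sym reaches) e)) ] (orbit k)
    third-point : Dec (f M ≡ 0) → ⊥
    third-point (yes fM≡0) = unreachable 1 (s≤s (≤-trans (s≤s z≤n) 2≤M)) (<⇒≢ 2≤M) (λ 1≡fM → 1+n≢0 (trans 1≡fM fM≡0))
    third-point (no fM≢0)  = unreachable 0 (s≤s z≤n) (<⇒≢ (≤-trans (s≤s z≤n) 2≤M)) (fM≢0 ∘ sym)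

module BypassCycle {M f g} (p : Inverses (suc M) f g)
                   (a<M : g M < M) (b<M : f M < M) (a≢b : g M ≢ f M) where
  open Inverses p
  open DeleteMax p a<M b<M a≢b

  iterate-bypass : ∀ {i} → i < M → ∀ k →
    (iterate f k i ≡ M × ∃ λ k′ → iterate f′ k′ i ≡ a) ⊎ (∃ λ k′ → iterate f′ k′ i ≡ iterate f k i)
  iterate-bypass i<M zero = inj₂ (0 , refl)
  iterate-bypass {i} i<M (suc k) with iterate-bypass i<M k
  ... | inj₁ (x≡M , k′ , reaches-a) = inj₂ (suc k′ , trans (cong f′ reaches-a) (trans f′a≡b (cong f (sym x≡M))))
  ... | inj₂ (k′ , same) with f (iterate f k i) ≟ M
  ...   | yes fx≡M = inj₁ (fx≡M , k′ , trans same (fi≡M⇒i≡a _ (iterate-bound p k (m<n⇒m<1+n i<M)) fx≡M))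
  ...   | no  fx≢M = inj₂ (suc k′ , trans (cong f′ same) (bypass-miss M f fx≢M))

  bypass-cycle : IsCycle (suc M) f → IsCycle M f′
  bypass-cycle cycle i j i<M j<M with cycle i j (m<n⇒m<1+n i<M) (m<n⇒m<1+n j<M)
  ... | k , reaches with iterate-bypass i<M k
  ...   | inj₁ (x≡M , _)   = ⊥-elim (<⇒≢ j<M (trans (sym reaches) x≡M))
  ...   | inj₂ (k′ , same) = k′ , trans same reaches

  enclosed-lift : ∀ {x} → x < M → x ≢ a → Enclosed M f′ x → Enclosed (suc M) f x
  enclosed-lift {x} x<M x≢a (i , i<M , nest) with i ≟ a
  ... | no i≢a rewrite f′-agrees x x<M x≢a | f′-agrees i i<M i≢a = i , m<n⇒m<1+n i<M , nest
  enclosed-lift {x} x<M x≢a (i , i<M , inj₁ (x<fx , a<x , _)) | yes refl rewrite f′-agrees x x<M x≢a =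
    a , m<n⇒m<1+n a<M , inj₁ (x<fx , a<x , subst (f x <_) (sym fa≡M) (fi<M x x<M x≢a))
  enclosed-lift {x} x<M x≢a (i , i<M , inj₂ (fx<x , x<a , b<fx)) | yes refl rewrite f′-agrees x x<M x≢a | f′a≡b =
    M , ≤-refl , inj₂ (fx<x , x<M , b<fx)

  stable-lift : StableAdjacency M f′ → ¬ Enclosed M f′ a → StableAdjacency (suc M) f
  stable-lift (x , x<M , adj , top) ¬enclosed with x ≟ a
  stable-lift (_ , _ , _ , inj₁ 1+a≡M) _ | yes refl =
    a , m<n⇒m<1+n a<M , inj₁ (trans 1+a≡M (sym fa≡M)) , inj₂ (inj₁ (cong suc fa≡M))
  stable-lift (_ , _ , _ , inj₂ (inj₁ 1+f′a≡M)) _ | yes refl =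
    M , ≤-refl , inj₂ (trans (cong suc (sym f′a≡b)) 1+f′a≡M) , inj₁ refl
  stable-lift (_ , _ , _ , inj₂ (inj₂ enclosed)) ¬enclosed | yes refl = ⊥-elim (¬enclosed enclosed)
  stable-lift (x , x<M , adj , top) _ | no x≢a = lift top
    where
    fx≡f′x : f x ≡ f′ x
    fx≡f′x = sym (f′-agrees x x<M x≢a)
    x~fx : Adjacent x (f x)
    x~fx = subst (Adjacent x) (sym fx≡f′x) adj
    fx<M : f x < M
    fx<M = fi<M x x<M x≢a
    witness : (suc x ≡ suc M ⊎ suc (f x) ≡ suc M ⊎ Enclosed (suc M) f x) → StableAdjacency (suc M) f
    witness cond = x , m<n⇒m<1+n x<M , x~fx , cond
    lift : (suc x ≡ M ⊎ suc (f′ x) ≡ M ⊎ Enclosed M f′ x) → StableAdjacency (suc M) f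
    lift (inj₂ (inj₂ enclosed)) = witness (inj₂ (inj₂ (enclosed-lift x<M x≢a enclosed)))
    lift (inj₁ 1+x≡M) = [ (λ 1+x≡fx → ⊥-elim (<⇒≢ fx<M (trans (sym 1+x≡fx) 1+x≡M)))
                        , below-top ] x~fx
      where
      below-top : suc (f x) ≡ x → StableAdjacency (suc M) f
      below-top 1+fx≡x with f M ≟ x
      ... | yes b≡x = M , ≤-refl , inj₂ (trans (cong suc b≡x) 1+x≡M) , inj₁ refl
      ... | no  b≢x = witness (inj₂ (inj₂ (M , ≤-refl , inj₂ (subst (f x <_) 1+fx≡x ≤-refl , x<M , b<fx))))
        where
        b<x : b < x
        b<x = ≤∧≢⇒< (≤-pred (subst (b <_) (sym 1+x≡M) b<M)) b≢x
        b<fx : b < f x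
        b<fx = ≤∧≢⇒< (≤-pred (subst (b <_) (sym 1+fx≡x) b<x))
                     (λ b≡fx → <⇒≢ x<M (sym (trans (sym (gb≡M)) (trans (cong g b≡fx) (g∘f≗id x (m<n⇒m<1+n x<M))))))
    lift (inj₂ (inj₁ 1+f′x≡M)) = [ above-top
                                 , (λ 1+fx≡x → ⊥-elim (<⇒≢ x<M (trans (sym 1+fx≡x) 1+fx≡M))) ] x~fx
      where
      1+fx≡M : suc (f x) ≡ M
      1+fx≡M = trans (cong suc fx≡f′x) 1+f′x≡M
      above-top : suc x ≡ f x → StableAdjacency (suc M) f
      above-top 1+x≡fx with suc a ≟ M
      ... | yes 1+a≡M = a , m<n⇒m<1+n a<M , inj₁ (trans 1+a≡M (sym fa≡M)) , inj₂ (inj₁ (cong suc fa≡M))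
      ... | no  1+a≢M = witness (inj₂ (inj₂ (a , m<n⇒m<1+n a<M ,
                          inj₁ (subst (x <_) 1+x≡fx ≤-refl , a<x , subst (f x <_) (sym fa≡M) fx<M))))
        where
        a<fx : a < f x
        a<fx = ≤∧≢⇒< (≤-pred (subst (a <_) (sym 1+fx≡M) a<M)) (λ a≡fx → 1+a≢M (trans (cong suc a≡fx) 1+fx≡M))
        a<x : a < x
        a<x = ≤∧≢⇒< (≤-pred (subst (a <_) (sym 1+x≡fx) a<fx)) (x≢a ∘ sym)

urBound-0 : URBound 0
urBound-0 f g p cycle = inj₁ z≤n

urBound-1 : URBound 1
urBound-1 f g p cycle = inj₁ (≤-trans (≤-reflexive (𝟙-no (g 0 <? 0 ×-dec f 0 <? 0) (λ (g0<0 , _) → n≮0 g0<0))) z≤n)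

urBound-2 : URBound 2
urBound-2 f g p cycle = inj₂ (counts , 0 , s≤s z≤n , inj₁ (sym f0≡1) , inj₂ (inj₁ (cong suc f0≡1)))
  where
  open Inverses p
  open CycleTop p cycle
  f1≡0 : f 1 ≡ 0
  f1≡0 = n<1⇒n≡0 (≤∧≢⇒< (≤-pred (f-bound 1 ≤-refl)) (f-top≢top ≤-refl))
  f0≢0 : f 0 ≢ 0
  f0≢0 f0≡0 = 0≢1+n (trans (sym (g∘f≗id 0 (s≤s z≤n))) (trans (cong g (trans f0≡0 (sym f1≡0))) (g∘f≗id 1 ≤-refl)))
  f0≡1 : f 0 ≡ 1
  f0≡1 = ≤-antisym (≤-pred (f-bound 0 (s≤s z≤n))) (n≢0⇒n>0 f0≢0)
  g1≡0 : g 1 ≡ 0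
  g1≡0 = trans (cong g (sym f0≡1)) (g∘f≗id 0 (s≤s z≤n))
  counts : suc (cPairs 2 f) ≡ urIndices 2 f g
  counts rewrite f0≡1 | f1≡0 | g1≡0 = refl

transfer-≤ : ∀ {C C′ U U′} S → C′ + U + S ≤ C + U′ → U′ ≤ C′ → U ≤ C
transfer-≤ {C} {C′} {U} {U′} S slack U′≤C′ = +-cancelˡ-≤ C′ U C (begin
  C′ + U      ≤⟨ m≤m+n (C′ + U) S ⟩
  C′ + U + S  ≤⟨ slack ⟩
  C + U′      ≤⟨ +-monoʳ-≤ C U′≤C′ ⟩
  C + C′      ≡⟨ +-comm C C′ ⟩
  C′ + C      ∎)
  where open ≤-Reasoning

transfer-defect : ∀ {C C′ U U′} S → C′ + U + S ≤ C + U′ → suc C′ ≡ U′ → U + S ≤ suc C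
transfer-defect {C} {C′} {U} {U′} S slack 1+C′≡U′ = +-cancelˡ-≤ C′ (U + S) (suc C) (begin
  C′ + (U + S)  ≡⟨ +-assoc C′ U S ⟨
  C′ + U + S    ≤⟨ slack ⟩
  C + U′        ≡⟨ cong (C +_) 1+C′≡U′ ⟨
  C + suc C′    ≡⟨ swap-suc C C′ ⟩
  C′ + suc C    ∎)
  where
  open ≤-Reasoning
  swap-suc : ∀ x y → x + suc y ≡ y + suc x
  swap-suc = solve-∀

urBound-step : ∀ {M} → 2 ≤ M → URBound M → URBound (suc M)
urBound-step {M} 2≤M ih f g p cycle =
  conclude (ih f′ g′ (bypass-inverses p) (bypass-cycle cycle)) bound
  where
  open Inverses p
  open CycleTop p cycle
  1≤M : 1 ≤ M
  1≤M = ≤-trans (s≤s z≤n) 2≤M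
  a<M : g M < M
  a<M = ≤∧≢⇒< (≤-pred (g-bound M ≤-refl)) (g-top≢top 1≤M)
  b<M : f M < M
  b<M = ≤∧≢⇒< (≤-pred (f-bound M ≤-refl)) (f-top≢top 1≤M)
  open DeleteMax p a<M b<M (g-top≢f-top 2≤M) using (f′; g′; a; bound)
  open BypassCycle p a<M b<M (g-top≢f-top 2≤M) using (bypass-cycle; stable-lift)
  C C′ U U′ : ℕ
  C  = cPairs (suc M) f
  C′ = cPairs M f′
  U  = urIndices (suc M) f g
  U′ = urIndices M f′ g′
  conclude : U′ ≤ C′ ⊎ (suc C′ ≡ U′ × StableAdjacency M f′) →
             (∃ λ K → (C′ + U + 2 * K ≤ C + U′) × (Enclosed M f′ a → 1 ≤ K)) →
             U ≤ C ⊎ (suc C ≡ U × StableAdjacency (suc M) f)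
  conclude (inj₁ U′≤C′) (K , slack , _) = inj₁ (transfer-≤ (2 * K) slack U′≤C′)
  conclude (inj₂ (1+C′≡U′ , _)) (suc K , slack , _) = inj₁ (<⇒≤ (≤-pred (begin
    2 + U            ≡⟨ +-comm 2 U ⟩
    U + 2            ≤⟨ +-monoʳ-≤ U (*-monoʳ-≤ 2 (s≤s z≤n)) ⟩
    U + 2 * suc K    ≤⟨ transfer-defect (2 * suc K) slack 1+C′≡U′ ⟩
    suc C            ∎)))
    where open ≤-Reasoning
  conclude (inj₂ (1+C′≡U′ , stable)) (zero , slack , enclosed⇒1≤0)
    with m≤n⇒m<n∨m≡n (subst (_≤ suc C) (+-identityʳ U) (transfer-defect 0 slack 1+C′≡U′))
  ... | inj₁ U<1+C  = inj₁ (≤-pred U<1+C)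
  ... | inj₂ U≡1+C  = inj₂ (sym U≡1+C , stable-lift stable (n≮0 ∘ enclosed⇒1≤0))

urBound : ∀ n → URBound n
urBound 0 = urBound-0
urBound 1 = urBound-1
urBound 2 = urBound-2
urBound (suc (suc (suc m))) = urBound-step (s≤s (s≤s z≤n)) (urBound (suc (suc m)))

urIndices≤cPairs : ∀ n f g → Inverses n f g → IsCycle n f → (∀ x → x < n → ¬ Adjacent x (f x)) →
                   urIndices n f g ≤ cPairs n f
urIndices≤cPairs n f g p cycle far with urBound n f g p cycle
... | inj₁ U≤C = U≤C
... | inj₂ (_ , x , x<n , adjacent , _) = ⊥-elim (far x x<n adjacent)

length-filter≡sum : ∀ {A : Set} {P : A → Set} (P? : Decidable P) (xs : List A) →
                    length (filter P? xs) ≡ sum (map (𝟙 ∘ P?) xs)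
length-filter≡sum P? []       = refl
length-filter≡sum P? (x ∷ xs) with P? x
... | yes _ = cong suc (length-filter≡sum P? xs)
... | no  _ = length-filter≡sum P? xs

sum-tabulate : ∀ n (h : Fin n → ℕ) (h′ : ℕ → ℕ) → (∀ x → h x ≡ h′ (toℕ x)) → sum (tabulate h) ≡ ∑< n h′
sum-tabulate zero    h h′ eq = refl
sum-tabulate (suc n) h h′ eq =
  trans (cong₂ _+_ (eq Fin.zero) (sum-tabulate n (h ∘ Fin.suc) (h′ ∘ suc) (eq ∘ Fin.suc))) (sym (∑-unfoldˡ n h′))

sum-map-allFin : ∀ n (h : Fin n → ℕ) (h′ : ℕ → ℕ) → (∀ x → h x ≡ h′ (toℕ x)) → sum (map h (allFin n)) ≡ ∑< n h′
sum-map-allFin n h h′ eq = trans (cong sum (map-tabulate (λ x → x) h)) (sum-tabulate n h h′ eq)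

sum-map-cartesianProduct : ∀ {A B : Set} (w : A × B → ℕ) (xs : List A) (ys : List B) →
  sum (map w (cartesianProduct xs ys)) ≡ sum (map (λ x → sum (map (λ y → w (x , y)) ys)) xs)
sum-map-cartesianProduct w []       ys = refl
sum-map-cartesianProduct w (x ∷ xs) ys = begin
  sum (map w (map (x ,_) ys ++ cartesianProduct xs ys))
    ≡⟨ cong sum (map-++ w (map (x ,_) ys) (cartesianProduct xs ys)) ⟩
  sum (map w (map (x ,_) ys) ++ map w (cartesianProduct xs ys))
    ≡⟨ sum-++ (map w (map (x ,_) ys)) (map w (cartesianProduct xs ys)) ⟩
  sum (map w (map (x ,_) ys)) + sum (map w (cartesianProduct xs ys))
    ≡⟨ cong₂ _+_ (cong sum (sym (map-∘ ys))) (sum-map-cartesianProduct w xs ys) ⟩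
  sum (map (λ y → w (x , y)) ys) + sum (map (λ x → sum (map (λ y → w (x , y)) ys)) xs) ∎
  where open ≡-Reasoning

-- The value 0 outside [0, n) is junk and never used.
extend : ∀ {n} → (Fin n → Fin n) → ℕ → ℕ
extend {n} h i with i <? n
... | yes i<n = toℕ (h (fromℕ< i<n))
... | no  _   = 0

extend-toℕ : ∀ {n} (h : Fin n → Fin n) x → extend h (toℕ x) ≡ toℕ (h x)
extend-toℕ {n} h x with toℕ x <? n
... | yes x<n = cong (toℕ ∘ h) (fromℕ<-toℕ x x<n)
... | no  x≮n = ⊥-elim (x≮n (toℕ<n x))

extend-fromℕ< : ∀ {n} (h : Fin n → Fin n) {i} (i<n : i < n) → extend h i ≡ toℕ (h (fromℕ< i<n))
extend-fromℕ< h i<n = trans (cong (extend h) (sym (toℕ-fromℕ< i<n))) (extend-toℕ h (fromℕ< i<n))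

module Underlying {n} (σ : Permutation′ n) where
  F G : ℕ → ℕ
  F = extend (σ ⟨$⟩ʳ_)
  G = extend (σ ⟨$⟩ˡ_)

  inverses : Inverses n F G
  inverses = record
    { f-bound = λ i i<n → subst (_< n) (sym (extend-fromℕ< (σ ⟨$⟩ʳ_) i<n)) (toℕ<n _)
    ; g-bound = λ i i<n → subst (_< n) (sym (extend-fromℕ< (σ ⟨$⟩ˡ_) i<n)) (toℕ<n _)
    ; g∘f≗id  = λ i i<n → begin
        G (F i)                                   ≡⟨ cong G (extend-fromℕ< (σ ⟨$⟩ʳ_) i<n) ⟩
        G (toℕ (σ ⟨$⟩ʳ fromℕ< i<n))               ≡⟨ extend-toℕ (σ ⟨$⟩ˡ_) _ ⟩
        toℕ (σ ⟨$⟩ˡ (σ ⟨$⟩ʳ fromℕ< i<n))          ≡⟨ cong toℕ (inverseˡ σ) ⟩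
        toℕ (fromℕ< i<n)                          ≡⟨ toℕ-fromℕ< i<n ⟩
        i                                         ∎
    ; f∘g≗id  = λ i i<n → begin
        F (G i)                                   ≡⟨ cong F (extend-fromℕ< (σ ⟨$⟩ˡ_) i<n) ⟩
        F (toℕ (σ ⟨$⟩ˡ fromℕ< i<n))               ≡⟨ extend-toℕ (σ ⟨$⟩ʳ_) _ ⟩
        toℕ (σ ⟨$⟩ʳ (σ ⟨$⟩ˡ fromℕ< i<n))          ≡⟨ cong toℕ (inverseʳ σ) ⟩
        toℕ (fromℕ< i<n)                          ≡⟨ toℕ-fromℕ< i<n ⟩
        i                                         ∎
    }
    where open ≡-Reasoning

  iterate-toℕ : ∀ k x → iterate F k (toℕ x) ≡ toℕ (iter σ k x)
  iterate-toℕ zero    x = refl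
  iterate-toℕ (suc k) x = trans (cong F (iterate-toℕ k x)) (extend-toℕ (σ ⟨$⟩ʳ_) _)

  isCycle : IsNCycle σ → IsCycle n F
  isCycle nCycle i j i<n j<n with nCycle (fromℕ< i<n) (fromℕ< j<n)
  ... | k , reaches = k , (begin
    iterate F k i                      ≡⟨ cong (iterate F k) (toℕ-fromℕ< i<n) ⟨
    iterate F k (toℕ (fromℕ< i<n))     ≡⟨ iterate-toℕ k _ ⟩
    toℕ (iter σ k (fromℕ< i<n))        ≡⟨ cong toℕ reaches ⟩
    toℕ (fromℕ< j<n)                   ≡⟨ toℕ-fromℕ< j<n ⟩
    j                                  ∎)
    where open ≡-Reasoning

  no-adjacent : (∀ i → MovesFar σ i) → ∀ x → x < n → ¬ Adjacent x (F x)
  no-adjacent far x x<n adjacent = <-irrefl (sym distance≡1) (subst (2 ≤_) distance≡ (far (fromℕ< x<n)))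
    where
    distance≡ : ∣ toℕ (σ ⟨$⟩ʳ fromℕ< x<n) - toℕ (fromℕ< x<n) ∣ ≡ ∣ F x - x ∣
    distance≡ = cong₂ ∣_-_∣ (sym (extend-fromℕ< (σ ⟨$⟩ʳ_) x<n)) (toℕ-fromℕ< x<n)
    distance≡1 : ∣ F x - x ∣ ≡ 1
    distance≡1 = trans (∣-∣-comm (F x) x) (Adjacent⇒∣-∣≡1 adjacent)

  numUR≡urIndices : numUR σ ≡ urIndices n F G
  numUR≡urIndices = trans (length-filter≡sum (isUR? σ) (allFin n)) (sum-map-allFin n _ (urIndex F G) same)
    where
    same : ∀ x → 𝟙 (isUR? σ x) ≡ urIndex F G (toℕ x)
    same x rewrite extend-toℕ (σ ⟨$⟩ʳ_) x | extend-toℕ (σ ⟨$⟩ˡ_) x = refl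

  numCPairs≡cPairs : numCPairs σ ≡ cPairs n F
  numCPairs≡cPairs = begin
    numCPairs σ
      ≡⟨ length-filter≡sum (isCPair? σ) (cartesianProduct (allFin n) (allFin n)) ⟩
    sum (map (𝟙 ∘ isCPair? σ) (cartesianProduct (allFin n) (allFin n)))
      ≡⟨ sum-map-cartesianProduct _ (allFin n) (allFin n) ⟩
    sum (map (λ x → sum (map (λ y → 𝟙 (isCPair? σ (x , y))) (allFin n))) (allFin n))
      ≡⟨ sum-map-allFin n _ _ (λ x → sum-map-allFin n _ _ (same x)) ⟩
    cPairs n F ∎
    where
    open ≡-Reasoning
    same : ∀ x y → 𝟙 (isCPair? σ (x , y)) ≡ cPair F (toℕ x) (toℕ y)
    same x y rewrite extend-toℕ (σ ⟨$⟩ʳ_) x | extend-toℕ (σ ⟨$⟩ʳ_) y = refl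

mainTheorem10 : ∀ (n : ℕ) (σ : Permutation′ n) →
    IsNCycle σ → (∀ (i : Fin n) → MovesFar σ i) →
    numUR σ ≤ numCPairs σ
mainTheorem10 n σ nCycle far = begin
  numUR σ          ≡⟨ numUR≡urIndices ⟩
  urIndices n F G  ≤⟨ urIndices≤cPairs n F G inverses (isCycle nCycle) (no-adjacent far) ⟩
  cPairs n F       ≡⟨ numCPairs≡cPairs ⟨
  numCPairs σ      ∎
  where
  open Underlying σ
  open ≤-Reasoning
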